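{- For $n\ge1$, the maximum of $\mathbf a(\pi)+\mathbf b(\pi)$ over $\pi\in\mathcal D(n)$ is $\binom n2$, and the minimum of $\mathbf a(\pi)+\mathbf b(\pi)$ over $\pi\in\mathcal D(n)$ is $\binom n2-g(n)$.
   Context: A Dyck path of semilength $n$ is a lattice path from $(0,0)$ to $(n,n)$ with unit north and east steps never going below $y=x$; $\mathcal D(n)$ is their set. The area $\mathbf a(\pi)$ is the number of whole unit cells between $\pi$ and the diagonal. With $h_i$ the $y$-coordinate of the east step of $\pi$ in column $i$ (strip $i-1\le x\le i$), the bounce points are $b_0=0$, $b_k=h_{b_{k-1}+1}$ until $b_m=n$, and the bounce is $\mathbf b(\pi)=\sum_{k=1}^m(n-b_k)$. The function $g:\mathbb N\to\mathbb N$ is defined by $g(0)=0$ and $g(n)=\max\{(k-1)(n-k)+g(n-k):1\le k\le n\}$ for $n\ge1$. -}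

module Defs where

open import Data.Nat using (ℕ; zero; suc; _+_; _*_; _∸_; _⊔_; _<ᵇ_)
open import Data.List using (List; []; _∷_; foldr; map; applyUpTo)
open import Data.Bool using (if_then_else_)
open import Data.Product using (Σ; _×_)
open import Data.Empty using (⊥)
open import Relation.Binary.PropositionalEquality using (_≡_)

data Step : Set where
  N E : Step

-- Ok d w : starting at excess d = (#N − #E) ≥ 0, the word w never goes
-- below the diagonal (excess never negative) and ends on it (excess 0).
Ok : ℕ → List Step → Set
Ok d       []      = d ≡ 0
Ok d       (N ∷ w) = Ok (suc d) w
Ok zero    (E ∷ w) = ⊥
Ok (suc d) (E ∷ w) = Ok d w

countN : List Step → ℕ
countN []      = 0
countN (N ∷ w) = suc (countN w)
countN (E ∷ w) = countN w

IsDyck : ℕ → List Step → Set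
IsDyck n w = Ok 0 w × countN w ≡ n

Dyck : ℕ → Set
Dyck n = Σ (List Step) (IsDyck n)

-- heightsFrom y w : list of y-coordinates of the east steps of w, in order,
-- when w starts at height y.  So (heights π) = h₁ ∷ h₂ ∷ … ∷ hₙ ∷ [].
heightsFrom : ℕ → List Step → List ℕ
heightsFrom y []      = []
heightsFrom y (N ∷ w) = heightsFrom (suc y) w
heightsFrom y (E ∷ w) = y ∷ heightsFrom y w

heights : List Step → List ℕ
heights = heightsFrom 0

-- 0-based lookup with default 0: nth hs i = h_{i+1}.
nth : List ℕ → ℕ → ℕ
nth []       _       = 0
nth (h ∷ hs) zero    = h
nth (h ∷ hs) (suc i) = nth hs i

-- area: column i contains exactly h_i − i whole cells between path and diagonal.
areaFrom : ℕ → List ℕ → ℕ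
areaFrom i []       = 0
areaFrom i (h ∷ hs) = (h ∸ i) + areaFrom (suc i) hs

area : List Step → ℕ
area w = areaFrom 1 (heights w)

-- bounce: from bounce point b, the next one is b' = h_{b+1}; add (n − b')
-- and continue while b' < n.  Fuel bounds the number of bounce points
-- (at most n, since they strictly increase for a Dyck path).
bounceFrom : ℕ → ℕ → List ℕ → ℕ → ℕ
bounceFrom zero    n hs b = 0
bounceFrom (suc f) n hs b =
  let b' = nth hs b in
  (n ∸ b') + (if b' <ᵇ n then bounceFrom f n hs b' else 0)

bounce : ℕ → List Step → ℕ
bounce n w = bounceFrom n n (heights w) 0

-- g(0) = 0, g(n) = max_{1≤k≤n} ((k−1)(n−k) + g(n−k)); fuel-based recursion,
-- with fuel n sufficient since arguments strictly decrease.
maxList : List ℕ → ℕ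
maxList = foldr _⊔_ 0

gF : ℕ → ℕ → ℕ
gF zero    _ = 0
gF (suc f) zero = 0
gF (suc f) (suc m) =
  maxList (applyUpTo (λ j → let k = suc j in
                              (j * (suc m ∸ k)) + gF f (suc m ∸ k)) (suc m))

g : ℕ → ℕ
g n = gF n n

{-# OPTIONS --safe #-}
module Submission where

-- Let h_i be the height of the east step in column i, so i ≤ h_i ≤ n and h is weakly
-- increasing; column i contributes h_i − i to the area, at most n − i.  Cut the columns into
-- blocks b+1, …, c between consecutive bounce points b < c = h_{b+1}.  The first column of a
-- block falls short of n − b − 1 by exactly the n − c that the bounce gains at c, which gives
-- a + b ≤ C(n,2).  Since h_i ≥ c on the block, each other column falls short by at most n − c,
-- so the block costs at most (k − 1)(m − k) with m = n − b and k = c − b; by the recursion for g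
-- these costs add up to at most g(n).  Both bounds are attained by concatenations of pyramids
-- N^k E^k: a single one for the maximum, and for the minimum the sizes k chosen by the maximum
-- in the recursion for g.

open import Defs
open import Data.Nat
  using (ℕ; zero; suc; _+_; _*_; _∸_; _≤_; _<_; _≥_; z≤n; s≤s; s≤s⁻¹; _<ᵇ_)
open import Data.Nat.Properties
open import Data.Nat.Combinatorics using (_C_; nC1≡n; nCk+nC[k+1]≡[n+1]C[k+1])
open import Data.Nat.Induction using (<-rec)
open import Data.Nat.Tactic.RingSolver using (solve-∀)
open import Algebra.Properties.CommutativeSemigroup +-commutativeSemigroup using (interchange; xy∙z≈xz∙y)
open import Data.List using (List; []; _∷_; _++_; map; replicate; length; applyUpTo)
open import Data.List.Properties using (length-replicate)
open import Data.List.Membership.Propositional using (_∈_)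
open import Data.List.Membership.Propositional.Properties using (∈-applyUpTo⁺; ∈-applyUpTo⁻)
open import Data.List.Relation.Unary.Any using (here; there)
open import Data.Bool using (T; true; false; if_then_else_)
open import Data.Product using (Σ; ∃₂; _×_; _,_; proj₁)
open import Data.Sum using (inj₁; inj₂)
open import Data.Empty using (⊥; ⊥-elim)
open import Function using (_∘_)
open import Relation.Binary.PropositionalEquality

∸-telescope : ∀ {a b c} → a ≤ b → b ≤ c → (b ∸ a) + (c ∸ b) ≡ c ∸ a
∸-telescope {b = b} z≤n b≤c = m+[n∸m]≡n b≤c
∸-telescope (s≤s a≤b) (s≤s b≤c) = ∸-telescope a≤b b≤c

∸-suc : ∀ {a b} → a < b → b ∸ a ≡ suc (b ∸ suc a)
∸-suc {zero} (s≤s _) = refl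
∸-suc {suc a} (s≤s a<b) = ∸-suc a<b

+-<ᵇ : ∀ k {m n} → (k + m <ᵇ k + n) ≡ (m <ᵇ n)
+-<ᵇ zero = refl
+-<ᵇ (suc k) = +-<ᵇ k

C2-suc : ∀ k → suc k C 2 ≡ k + k C 2
C2-suc k = trans (sym (nCk+nC[k+1]≡[n+1]C[k+1] k 1)) (cong (_+ k C 2) (nC1≡n k))

C2-+ : ∀ a b → (a + b) C 2 ≡ a C 2 + a * b + b C 2
C2-+ zero b = refl
C2-+ (suc a) b = begin
  suc (a + b) C 2                       ≡⟨ C2-suc (a + b) ⟩
  (a + b) + (a + b) C 2                 ≡⟨ cong ((a + b) +_) (C2-+ a b) ⟩
  (a + b) + (a C 2 + a * b + b C 2)     ≡⟨ regroup a b (a C 2) (a * b) (b C 2) ⟩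
  (a + a C 2) + (b + a * b) + b C 2     ≡⟨ cong (λ x → x + (b + a * b) + b C 2) (sym (C2-suc a)) ⟩
  suc a C 2 + suc a * b + b C 2         ∎
  where
  open ≡-Reasoning
  regroup : ∀ a b x y z → (a + b) + (x + y + z) ≡ (a + x) + (b + y) + z
  regroup = solve-∀

sumFrom : (ℕ → ℕ) → ℕ → ℕ → ℕ
sumFrom F a zero    = 0
sumFrom F a (suc k) = F a + sumFrom F (suc a) k

sumRange : (ℕ → ℕ) → ℕ → ℕ → ℕ
sumRange F a b = sumFrom F a (b ∸ a)

sumFrom-+ : ∀ F a k l → sumFrom F a (k + l) ≡ sumFrom F a k + sumFrom F (a + k) l
sumFrom-+ F a zero    l = cong (λ x → sumFrom F x l) (sym (+-identityʳ a))
sumFrom-+ F a (suc k) l = begin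
  F a + sumFrom F (suc a) (k + l)
    ≡⟨ cong (F a +_) (sumFrom-+ F (suc a) k l) ⟩
  F a + (sumFrom F (suc a) k + sumFrom F (suc a + k) l)
    ≡⟨ sym (+-assoc (F a) _ _) ⟩
  F a + sumFrom F (suc a) k + sumFrom F (suc a + k) l
    ≡⟨ cong (λ x → F a + sumFrom F (suc a) k + sumFrom F x l) (sym (+-suc a k)) ⟩
  F a + sumFrom F (suc a) k + sumFrom F (a + suc k) l ∎
  where open ≡-Reasoning

sumFrom-suc : ∀ F a k → sumFrom F (suc a) k ≡ sumFrom (F ∘ suc) a k
sumFrom-suc F a zero    = refl
sumFrom-suc F a (suc k) = cong (F (suc a) +_) (sumFrom-suc F (suc a) k)

sumFrom-mono-≤ : ∀ {F G} a k → (∀ {i} → a ≤ i → i < a + k → F i ≤ G i) →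
                 sumFrom F a k ≤ sumFrom G a k
sumFrom-mono-≤ a zero    F≤G = z≤n
sumFrom-mono-≤ a (suc k) F≤G = +-mono-≤ (F≤G ≤-refl a<a+suc-k)
  (sumFrom-mono-≤ (suc a) k (λ {i} a<i i< → F≤G (<⇒≤ a<i) (subst (i <_) (sym (+-suc a k)) i<)))
  where
  a<a+suc-k : a < a + suc k
  a<a+suc-k = subst (a <_) (sym (+-suc a k)) (s≤s (m≤m+n a k))

sumFrom-+-const : ∀ F x a k → sumFrom (λ i → F i + x) a k ≡ sumFrom F a k + k * x
sumFrom-+-const F x a zero    = refl
sumFrom-+-const F x a (suc k) = begin
  (F a + x) + sumFrom (λ i → F i + x) (suc a) k   ≡⟨ cong ((F a + x) +_) (sumFrom-+-const F x (suc a) k) ⟩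
  (F a + x) + (sumFrom F (suc a) k + k * x)       ≡⟨ interchange (F a) x _ (k * x) ⟩
  (F a + sumFrom F (suc a) k) + (x + k * x)       ∎
  where open ≡-Reasoning

sumRange-empty : ∀ F a → sumRange F a a ≡ 0
sumRange-empty F a = cong (sumFrom F a) (n∸n≡0 a)

sumRange-split : ∀ F {a b c} → a ≤ b → b ≤ c → sumRange F a c ≡ sumRange F a b + sumRange F b c
sumRange-split F {a} {b} {c} a≤b b≤c = begin
  sumFrom F a (c ∸ a)
    ≡⟨ cong (sumFrom F a) (sym (∸-telescope a≤b b≤c)) ⟩
  sumFrom F a ((b ∸ a) + (c ∸ b))
    ≡⟨ sumFrom-+ F a (b ∸ a) (c ∸ b) ⟩
  sumFrom F a (b ∸ a) + sumFrom F (a + (b ∸ a)) (c ∸ b)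
    ≡⟨ cong (λ x → sumRange F a b + sumFrom F x (c ∸ b)) (m+[n∸m]≡n a≤b) ⟩
  sumRange F a b + sumRange F b c ∎
  where open ≡-Reasoning

sumRange-uncons : ∀ F {a b} → a < b → sumRange F a b ≡ F a + sumRange F (suc a) b
sumRange-uncons F a<b = cong (sumFrom F _) (∸-suc a<b)

sumRange-mono-≤ : ∀ {F G a b} → a ≤ b → (∀ {i} → a ≤ i → i < b → F i ≤ G i) →
                  sumRange F a b ≤ sumRange G a b
sumRange-mono-≤ {a = a} a≤b F≤G =
  sumFrom-mono-≤ a _ (λ {i} a≤i i< → F≤G a≤i (subst (i <_) (m+[n∸m]≡n a≤b) i<))

sumRange-+-const : ∀ F x a b → sumRange (λ i → F i + x) a b ≡ sumRange F a b + (b ∸ a) * x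
sumRange-+-const F x a b = sumFrom-+-const F x a (b ∸ a)

sum-triangle : ∀ n → sumRange (λ i → n ∸ suc i) 0 n ≡ n C 2
sum-triangle zero    = refl
sum-triangle (suc n) = begin
  n + sumFrom (λ i → suc n ∸ suc i) 1 n   ≡⟨ cong (n +_) (sumFrom-suc _ 0 n) ⟩
  n + sumRange (λ i → n ∸ suc i) 0 n      ≡⟨ cong (n +_) (sum-triangle n) ⟩
  n + n C 2                               ≡⟨ sym (C2-suc n) ⟩
  suc n C 2                               ∎
  where open ≡-Reasoning

∈⇒≤maxList : ∀ {x xs} → x ∈ xs → x ≤ maxList xs
∈⇒≤maxList {xs = y ∷ ys} (here refl)  = m≤m⊔n y (maxList ys)
∈⇒≤maxList {xs = y ∷ ys} (there x∈ys) = ≤-trans (∈⇒≤maxList x∈ys) (m≤n⊔m y (maxList ys))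

maxList-∈ : ∀ x xs → maxList (x ∷ xs) ∈ x ∷ xs
maxList-∈ x []       = here (⊔-identityʳ x)
maxList-∈ x (y ∷ ys) with ⊔-sel x (maxList (y ∷ ys))
... | inj₁ x⊔m≡x = here x⊔m≡x
... | inj₂ x⊔m≡m = there (subst (_∈ y ∷ ys) (sym x⊔m≡m) (maxList-∈ y ys))

applyUpTo-cong : ∀ {F G : ℕ → ℕ} → (∀ j → F j ≡ G j) → ∀ m → applyUpTo F m ≡ applyUpTo G m
applyUpTo-cong F≡G zero    = refl
applyUpTo-cong F≡G (suc m) = cong₂ _∷_ (F≡G 0) (applyUpTo-cong (F≡G ∘ suc) m)

gF-zero : ∀ f → gF f 0 ≡ 0
gF-zero zero    = refl
gF-zero (suc f) = refl

gF-fuel-irrelevant : ∀ {e f} m → m ≤ e → m ≤ f → gF e m ≡ gF f m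
gF-fuel-irrelevant {e} {f} zero _ _ = trans (gF-zero e) (sym (gF-zero f))
gF-fuel-irrelevant {suc e} {suc f} (suc m) (s≤s m≤e) (s≤s m≤f) =
  cong maxList (applyUpTo-cong (λ j → cong (j * (m ∸ j) +_)
    (gF-fuel-irrelevant (m ∸ j) (≤-trans (m∸n≤m m j) m≤e) (≤-trans (m∸n≤m m j) m≤f))) (suc m))

-- The term k = j + 1 of the maximum defining g (m + 1).
splitValue : ℕ → ℕ → ℕ
splitValue m j = j * (m ∸ j) + g (m ∸ j)

g-suc : ∀ m → g (suc m) ≡ maxList (applyUpTo (splitValue m) (suc m))
g-suc m = cong maxList (applyUpTo-cong (λ j → cong (j * (m ∸ j) +_)
  (gF-fuel-irrelevant (m ∸ j) (m∸n≤m m j) ≤-refl)) (suc m))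

split≤g : ∀ j r → j * r + g r ≤ g (suc (j + r))
split≤g j r = begin
  j * r + g r
    ≡⟨ cong (λ x → j * x + g x) (sym (m+n∸m≡n j r)) ⟩
  splitValue (j + r) j
    ≤⟨ ∈⇒≤maxList (∈-applyUpTo⁺ (splitValue (j + r)) (s≤s (m≤m+n j r))) ⟩
  maxList (applyUpTo (splitValue (j + r)) (suc (j + r)))
    ≡⟨ sym (g-suc (j + r)) ⟩
  g (suc (j + r)) ∎
  where open ≤-Reasoning

g-attained : ∀ m → ∃₂ λ j r → j + r ≡ m × j * r + g r ≡ g (suc m)
g-attained m with ∈-applyUpTo⁻ (splitValue m) (maxList-∈ (splitValue m 0) (applyUpTo (splitValue m ∘ suc) m))
... | j , s≤s j≤m , max≡ = j , m ∸ j , m+[n∸m]≡n j≤m , sym (trans (g-suc m) max≡)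

record DyckHeights (n : ℕ) (hs : List ℕ) : Set where
  field
    length≡ : length hs ≡ n
    above-diagonal : ∀ {i} → i < n → i < nth hs i
    bounded : ∀ {i} → i < n → nth hs i ≤ n
    monotone : ∀ {i j} → i ≤ j → j < n → nth hs i ≤ nth hs j

length-heightsFrom : ∀ {d} w y → Ok d w → length (heightsFrom y w) ≡ countN w + d
length-heightsFrom         []      y ok = sym ok
length-heightsFrom {d}     (N ∷ w) y ok = trans (length-heightsFrom w (suc y) ok) (+-suc (countN w) d)
length-heightsFrom {suc d} (E ∷ w) y ok = trans (cong suc (length-heightsFrom w y ok)) (sym (+-suc (countN w) d))

heightsFrom-≥ : ∀ w y {i} → i < length (heightsFrom y w) → y ≤ nth (heightsFrom y w) i
heightsFrom-≥ (N ∷ w) y       i<  = <⇒≤ (heightsFrom-≥ w (suc y) i<)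
heightsFrom-≥ (E ∷ w) y {zero}  _ = ≤-refl
heightsFrom-≥ (E ∷ w) y {suc i} (s≤s i<) = heightsFrom-≥ w y i<

heightsFrom-≤ : ∀ w y {i} → i < length (heightsFrom y w) → nth (heightsFrom y w) i ≤ y + countN w
heightsFrom-≤ (N ∷ w) y       i<  = ≤-trans (heightsFrom-≤ w (suc y) i<) (≤-reflexive (sym (+-suc y (countN w))))
heightsFrom-≤ (E ∷ w) y {zero}  _ = m≤m+n y (countN w)
heightsFrom-≤ (E ∷ w) y {suc i} (s≤s i<) = heightsFrom-≤ w y i<

heightsFrom-monotone : ∀ w y {i j} → i ≤ j → j < length (heightsFrom y w) →
                       nth (heightsFrom y w) i ≤ nth (heightsFrom y w) j
heightsFrom-monotone (N ∷ w) y i≤j j< = heightsFrom-monotone w (suc y) i≤j j<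
heightsFrom-monotone (E ∷ w) y {zero} {zero}  _ _ = ≤-refl
heightsFrom-monotone (E ∷ w) y {zero} {suc j} _ (s≤s j<) = heightsFrom-≥ w y j<
heightsFrom-monotone (E ∷ w) y {suc i} {suc j} (s≤s i≤j) (s≤s j<) = heightsFrom-monotone w y i≤j j<

-- w starts at the point (x , x + d), so its i-th east step (from 0) lies in column x + i + 1.
heightsFrom-above-diagonal : ∀ {d} w x → Ok d w → ∀ {i} → i < length (heightsFrom (x + d) w) →
                             x + i < nth (heightsFrom (x + d) w) i
heightsFrom-above-diagonal {d} (N ∷ w) x ok {i} i< =
  subst (λ y → x + i < nth (heightsFrom y w) i) (+-suc x d)
    (heightsFrom-above-diagonal w x ok (subst (λ y → i < length (heightsFrom y w)) (sym (+-suc x d)) i<))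
heightsFrom-above-diagonal {suc d} (E ∷ w) x ok {zero} _ = +-monoʳ-< x (s≤s z≤n)
heightsFrom-above-diagonal {suc d} (E ∷ w) x ok {suc i} (s≤s i<) rewrite +-suc x d | +-suc x i =
  heightsFrom-above-diagonal w (suc x) ok i<

dyckHeights : ∀ {n} w → IsDyck n w → DyckHeights n (heights w)
dyckHeights {n} w (ok , countN≡n) = record
  { length≡        = length≡
  ; above-diagonal = λ i<n → heightsFrom-above-diagonal w 0 ok (in-range i<n)
  ; bounded        = λ i<n → subst (_ ≤_) countN≡n (heightsFrom-≤ w 0 (in-range i<n))
  ; monotone       = λ i≤j j<n → heightsFrom-monotone w 0 i≤j (in-range j<n)
  }
  where
  length≡ : length (heights w) ≡ n
  length≡ = trans (length-heightsFrom w 0 ok) (trans (+-identityʳ (countN w)) countN≡n)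
  in-range : ∀ {i} → i < n → i < length (heights w)
  in-range {i} = subst (i <_) (sym length≡)

-- The sum of n − b′ over the bounce points b′ after the bounce point b (0 when b = n).
bounceAfter : ℕ → ℕ → List ℕ → ℕ → ℕ
bounceAfter f n hs b = if b <ᵇ n then bounceFrom f n hs b else 0

bounceAfter-end : ∀ f n hs → bounceAfter f n hs n ≡ 0
bounceAfter-end f n hs with n <ᵇ n | <ᵇ⇒< n n
... | false | _   = refl
... | true  | n<n = ⊥-elim (<-irrefl refl (n<n _))

bounceAfter-suc : ∀ f {n} hs {b} → b < n →
                  bounceAfter (suc f) n hs b ≡ (n ∸ nth hs b) + bounceAfter f n hs (nth hs b)
bounceAfter-suc f {n} hs {b} b<n with b <ᵇ n | <⇒<ᵇ b<n
... | true | _ = refl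

bounceAfter-shift : ∀ {k m L hs} → (∀ {i} → i < m → nth L (k + i) ≡ k + nth hs i) →
                    ∀ f b → bounceAfter f (k + m) L (k + b) ≡ bounceAfter f m hs b
bounceAfter-shift {k} {m} {L} {hs} L≡k+hs f b rewrite +-<ᵇ k {b} {m} with b <ᵇ m in b<ᵇm
... | false = refl
... | true  = shifted f
  where
  shifted : ∀ f → bounceFrom f (k + m) L (k + b) ≡ bounceFrom f m hs b
  shifted zero    = refl
  shifted (suc f) rewrite L≡k+hs (<ᵇ⇒< b m (subst T (sym b<ᵇm) _)) =
    cong₂ _+_ ([m+n]∸[m+o]≡n∸o k m (nth hs b)) (bounceAfter-shift L≡k+hs f (nth hs b))

module Bounce {n hs} (dyck : DyckHeights n hs) where
  open DyckHeights dyck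

  H : ℕ → ℕ
  H = nth hs

  no-fuel : ∀ {b} → b < n → n ∸ b ≤ 0 → ⊥
  no-fuel b<n = <⇒≱ (m<n⇒0<n∸m b<n)

  fuel-pred : ∀ {b f} → b < n → n ∸ b ≤ suc f → n ∸ H b ≤ f
  fuel-pred b<n fuel = s≤s⁻¹ (≤-trans (∸-monoʳ-< (above-diagonal b<n) (bounded b<n)) fuel)

  bounce-induction : (P : ℕ → ℕ → Set) → P n 0 →
                     (∀ {b B} → b < n → P (H b) B → P b ((n ∸ H b) + B)) →
                     ∀ f {b} → b ≤ n → n ∸ b ≤ f → P b (bounceAfter f n hs b)
  bounce-induction P base step f {b} b≤n fuel with m≤n⇒m<n∨m≡n b≤n | f
  ... | inj₂ refl | f′     = subst (P _) (sym (bounceAfter-end f′ _ hs)) base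
  ... | inj₁ b<n  | zero   = ⊥-elim (no-fuel b<n fuel)
  ... | inj₁ b<n  | suc f′ = subst (P b) (sym (bounceAfter-suc f′ hs b<n))
                               (step b<n (bounce-induction P base step f′ (bounded b<n) (fuel-pred b<n fuel)))

  bounceAfter-fuel-irrelevant : ∀ {e f b} → b ≤ n → n ∸ b ≤ e → n ∸ b ≤ f →
                                bounceAfter e n hs b ≡ bounceAfter f n hs b
  bounceAfter-fuel-irrelevant {e} {f} b≤n fuel-e fuel-f =
    sym (bounce-induction Agrees (λ f _ → bounceAfter-end f n hs) step e b≤n fuel-e f fuel-f)
    where
    Agrees : ℕ → ℕ → Set
    Agrees b B = ∀ f → n ∸ b ≤ f → bounceAfter f n hs b ≡ B
    step : ∀ {b B} → b < n → Agrees (H b) B → Agrees b ((n ∸ H b) + B)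
    step b<n agrees zero    fuel = ⊥-elim (no-fuel b<n fuel)
    step b<n agrees (suc f) fuel =
      trans (bounceAfter-suc f hs b<n) (cong (_ +_) (agrees f (fuel-pred b<n fuel)))

  -- Columns are indexed from 0: H i is the height of the east step in column i + 1.
  columnArea columnMaxArea : ℕ → ℕ
  columnArea    i = H i ∸ suc i
  columnMaxArea i = n ∸ suc i

  tailArea tailMaxArea : ℕ → ℕ
  tailArea    b = sumRange columnArea b n
  tailMaxArea b = sumRange columnMaxArea b n

  tail-split : ∀ F {b} → b < n → sumRange F b n ≡ sumRange F b (H b) + sumRange F (H b) n
  tail-split F b<n = sumRange-split F (<⇒≤ (above-diagonal b<n)) (bounded b<n)

  block-upper : ∀ {b} → b < n →
                sumRange columnArea b (H b) + (n ∸ H b) ≤ sumRange columnMaxArea b (H b)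
  block-upper {b} b<n = begin
    sumRange columnArea b c + (n ∸ c)
      ≡⟨ cong (_+ (n ∸ c)) (sumRange-uncons columnArea b<c) ⟩
    (columnArea b + sumRange columnArea (suc b) c) + (n ∸ c)
      ≡⟨ xy∙z≈xz∙y (columnArea b) _ (n ∸ c) ⟩
    (columnArea b + (n ∸ c)) + sumRange columnArea (suc b) c
      ≡⟨ cong (_+ sumRange columnArea (suc b) c) (∸-telescope b<c (bounded b<n)) ⟩
    columnMaxArea b + sumRange columnArea (suc b) c
      ≤⟨ +-monoʳ-≤ (columnMaxArea b) (sumRange-mono-≤ b<c column≤) ⟩
    columnMaxArea b + sumRange columnMaxArea (suc b) c
      ≡⟨ sym (sumRange-uncons columnMaxArea b<c) ⟩
    sumRange columnMaxArea b c ∎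
    where
    open ≤-Reasoning
    c = H b
    b<c : b < c
    b<c = above-diagonal b<n
    column≤ : ∀ {i} → suc b ≤ i → i < c → columnArea i ≤ columnMaxArea i
    column≤ {i} _ i<c = ∸-monoˡ-≤ (suc i) (bounded (<-≤-trans i<c (bounded b<n)))

  block-lower : ∀ {b} → b < n →
                sumRange columnMaxArea b (H b) ≤ sumRange columnArea b (H b) + (H b ∸ b) * (n ∸ H b)
  block-lower {b} b<n = begin
    sumRange columnMaxArea b c                         ≤⟨ sumRange-mono-≤ (<⇒≤ b<c) column≤ ⟩
    sumRange (λ i → columnArea i + (n ∸ c)) b c        ≡⟨ sumRange-+-const columnArea (n ∸ c) b c ⟩
    sumRange columnArea b c + (c ∸ b) * (n ∸ c)        ∎
    where
    open ≤-Reasoning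
    c = H b
    b<c : b < c
    b<c = above-diagonal b<n
    column≤ : ∀ {i} → b ≤ i → i < c → columnMaxArea i ≤ columnArea i + (n ∸ c)
    column≤ {i} b≤i i<c = begin
      n ∸ suc i
        ≡⟨ sym (∸-telescope i<c (bounded b<n)) ⟩
      (c ∸ suc i) + (n ∸ c)
        ≤⟨ +-monoˡ-≤ (n ∸ c) (∸-monoˡ-≤ (suc i) (monotone b≤i (<-≤-trans i<c (bounded b<n)))) ⟩
      columnArea i + (n ∸ c) ∎

  tailArea+bounce≤tailMaxArea : ∀ f {b} → b ≤ n → n ∸ b ≤ f →
                                tailArea b + bounceAfter f n hs b ≤ tailMaxArea b
  tailArea+bounce≤tailMaxArea = bounce-induction Below base step
    where
    Below : ℕ → ℕ → Set
    Below b B = tailArea b + B ≤ tailMaxArea b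
    base : Below n 0
    base = ≤-trans (≤-reflexive (trans (+-identityʳ _) (sumRange-empty columnArea n))) z≤n
    step : ∀ {b B} → b < n → Below (H b) B → Below b ((n ∸ H b) + B)
    step {b} {B} b<n below = begin
      tailArea b + (r + B)
        ≡⟨ cong (_+ (r + B)) (tail-split columnArea b<n) ⟩
      (sumRange columnArea b c + tailArea c) + (r + B)
        ≡⟨ interchange (sumRange columnArea b c) (tailArea c) r B ⟩
      (sumRange columnArea b c + r) + (tailArea c + B)
        ≤⟨ +-mono-≤ (block-upper b<n) below ⟩
      sumRange columnMaxArea b c + tailMaxArea c
        ≡⟨ sym (tail-split columnMaxArea b<n) ⟩
      tailMaxArea b ∎
      where
      open ≤-Reasoning
      c = H b
      r = n ∸ c

  tailMaxArea≤tailArea+bounce+g : ∀ f {b} → b ≤ n → n ∸ b ≤ f →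
                                  tailMaxArea b ≤ tailArea b + bounceAfter f n hs b + g (n ∸ b)
  tailMaxArea≤tailArea+bounce+g = bounce-induction Above base step
    where
    Above : ℕ → ℕ → Set
    Above b B = tailMaxArea b ≤ tailArea b + B + g (n ∸ b)
    base : Above n 0
    base = ≤-trans (≤-reflexive (sumRange-empty columnMaxArea n)) z≤n
    regroup : ∀ x r jr a B gr → (x + (r + jr)) + (a + B + gr) ≡ (x + a) + (r + B) + (jr + gr)
    regroup = solve-∀
    step : ∀ {b B} → b < n → Above (H b) B → Above b ((n ∸ H b) + B)
    step {b} {B} b<n above = begin
      tailMaxArea b
        ≡⟨ tail-split columnMaxArea b<n ⟩
      sumRange columnMaxArea b c + tailMaxArea c
        ≤⟨ +-mono-≤ (block-lower b<n) above ⟩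
      (X + (c ∸ b) * r) + (tailArea c + B + g r)
        ≡⟨ cong (λ s → (X + s * r) + (tailArea c + B + g r)) (∸-suc b<c) ⟩
      (X + (r + j * r)) + (tailArea c + B + g r)
        ≡⟨ regroup X r (j * r) (tailArea c) B (g r) ⟩
      (X + tailArea c) + (r + B) + (j * r + g r)
        ≤⟨ +-monoʳ-≤ _ (split≤g j r) ⟩
      (X + tailArea c) + (r + B) + g (suc (j + r))
        ≡⟨ cong₂ (λ a m → a + (r + B) + g m) (sym (tail-split columnArea b<n)) gap ⟩
      tailArea b + (r + B) + g (n ∸ b) ∎
      where
      open ≤-Reasoning
      c = H b
      r = n ∸ c
      j = c ∸ suc b
      X = sumRange columnArea b c
      b<c : b < c
      b<c = above-diagonal b<n
      gap : suc (j + r) ≡ n ∸ b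
      gap = trans (cong suc (∸-telescope b<c (bounded b<n))) (sym (∸-suc b<n))

areaFrom-sumFrom : ∀ (F : ℕ → ℕ) a xs → (∀ i → F (a + i) ≡ nth xs i) →
                   areaFrom (suc a) xs ≡ sumFrom (λ i → F i ∸ suc i) a (length xs)
areaFrom-sumFrom F a []       F≡xs = refl
areaFrom-sumFrom F a (x ∷ xs) F≡xs = cong₂ _+_
  (cong (_∸ suc a) (sym (trans (cong F (sym (+-identityʳ a))) (F≡xs 0))))
  (areaFrom-sumFrom F (suc a) xs (λ i → trans (cong F (sym (+-suc a i))) (F≡xs (suc i))))

area+bounce : ℕ → List Step → ℕ
area+bounce n w = area w + bounce n w

area≡tailArea : ∀ {n} w (d : IsDyck n w) → area w ≡ Bounce.tailArea (dyckHeights w d) 0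
area≡tailArea w d = trans (areaFrom-sumFrom (nth (heights w)) 0 (heights w) (λ _ → refl))
                          (cong (sumFrom _ 0) (DyckHeights.length≡ (dyckHeights w d)))

bounce≡bounceAfter : ∀ {m f} w → IsDyck m w → m ≤ f → bounce m w ≡ bounceAfter f m (heights w) 0
bounce≡bounceAfter {zero}  _ _ _   = refl
bounce≡bounceAfter {suc m} w d m≤f = Bounce.bounceAfter-fuel-irrelevant (dyckHeights w d) z≤n ≤-refl m≤f

area+bounce≤C2 : ∀ {n} w → IsDyck n w → area+bounce n w ≤ n C 2
area+bounce≤C2 {n} w d = begin
  area w + bounce n w                      ≡⟨ cong₂ _+_ (area≡tailArea w d) (bounce≡bounceAfter w d ≤-refl) ⟩
  tailArea 0 + bounceAfter n n (heights w) 0  ≤⟨ tailArea+bounce≤tailMaxArea n z≤n ≤-refl ⟩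
  tailMaxArea 0                            ≡⟨ sum-triangle n ⟩
  n C 2                                    ∎
  where
  open Bounce (dyckHeights w d)
  open ≤-Reasoning

C2∸g≤area+bounce : ∀ {n} w → IsDyck n w → n C 2 ∸ g n ≤ area+bounce n w
C2∸g≤area+bounce {n} w d = m≤n+o⇒m∸n≤o (n C 2) (g n) (begin
  n C 2
    ≡⟨ sym (sum-triangle n) ⟩
  tailMaxArea 0
    ≤⟨ tailMaxArea≤tailArea+bounce+g n z≤n ≤-refl ⟩
  tailArea 0 + bounceAfter n n (heights w) 0 + g n
    ≡⟨ cong (_+ g n) (cong₂ _+_ (sym (area≡tailArea w d)) (sym (bounce≡bounceAfter w d ≤-refl))) ⟩
  area w + bounce n w + g n
    ≡⟨ +-comm (area w + bounce n w) (g n) ⟩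
  g n + (area w + bounce n w) ∎)
  where
  open Bounce (dyckHeights w d)
  open ≤-Reasoning

pyramid : ℕ → List Step → List Step
pyramid k w = replicate k N ++ replicate k E ++ w

Ok-replicate-N : ∀ k {d} w → Ok (k + d) w → Ok d (replicate k N ++ w)
Ok-replicate-N zero        w ok = ok
Ok-replicate-N (suc k) {d} w ok = Ok-replicate-N k w (subst (λ e → Ok e w) (sym (+-suc k d)) ok)

Ok-replicate-E : ∀ k {d} w → Ok d w → Ok (k + d) (replicate k E ++ w)
Ok-replicate-E zero    w ok = ok
Ok-replicate-E (suc k) w ok = Ok-replicate-E k w ok

countN-replicate-N : ∀ k w → countN (replicate k N ++ w) ≡ k + countN w
countN-replicate-N zero    w = refl
countN-replicate-N (suc k) w = cong suc (countN-replicate-N k w)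

countN-replicate-E : ∀ k w → countN (replicate k E ++ w) ≡ countN w
countN-replicate-E zero    w = refl
countN-replicate-E (suc k) w = countN-replicate-E k w

pyramid-isDyck : ∀ k {m} w → IsDyck m w → IsDyck (k + m) (pyramid k w)
pyramid-isDyck k w (ok , countN≡m) =
  Ok-replicate-N k _ (Ok-replicate-E k w ok) ,
  trans (countN-replicate-N k _) (cong (k +_) (trans (countN-replicate-E k w) countN≡m))

heightsFrom-replicate-N : ∀ k y w → heightsFrom y (replicate k N ++ w) ≡ heightsFrom (k + y) w
heightsFrom-replicate-N zero    y w = refl
heightsFrom-replicate-N (suc k) y w =
  trans (heightsFrom-replicate-N k (suc y) w) (cong (λ z → heightsFrom z w) (+-suc k y))

heightsFrom-replicate-E : ∀ k y w → heightsFrom y (replicate k E ++ w) ≡ replicate k y ++ heightsFrom y w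
heightsFrom-replicate-E zero    y w = refl
heightsFrom-replicate-E (suc k) y w = cong (y ∷_) (heightsFrom-replicate-E k y w)

heightsFrom-+ : ∀ k y w → heightsFrom (k + y) w ≡ map (k +_) (heightsFrom y w)
heightsFrom-+ k y []      = refl
heightsFrom-+ k y (N ∷ w) = trans (cong (λ z → heightsFrom z w) (sym (+-suc k y))) (heightsFrom-+ k (suc y) w)
heightsFrom-+ k y (E ∷ w) = cong (k + y ∷_) (heightsFrom-+ k y w)

heights-pyramid : ∀ k w → heights (pyramid k w) ≡ replicate k k ++ map (k +_) (heights w)
heights-pyramid k w = begin
  heightsFrom 0 (pyramid k w)
    ≡⟨ heightsFrom-replicate-N k 0 _ ⟩
  heightsFrom (k + 0) (replicate k E ++ w)
    ≡⟨ heightsFrom-replicate-E k (k + 0) w ⟩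
  replicate k (k + 0) ++ heightsFrom (k + 0) w
    ≡⟨ cong₂ (λ y hs → replicate k y ++ hs) (+-identityʳ k) (heightsFrom-+ k 0 w) ⟩
  replicate k k ++ map (k +_) (heights w) ∎
  where open ≡-Reasoning

areaFrom-++ : ∀ i xs ys → areaFrom i (xs ++ ys) ≡ areaFrom i xs + areaFrom (length xs + i) ys
areaFrom-++ i []       ys = refl
areaFrom-++ i (x ∷ xs) ys = begin
  (x ∸ i) + areaFrom (suc i) (xs ++ ys)
    ≡⟨ cong ((x ∸ i) +_) (areaFrom-++ (suc i) xs ys) ⟩
  (x ∸ i) + (areaFrom (suc i) xs + areaFrom (length xs + suc i) ys)
    ≡⟨ sym (+-assoc (x ∸ i) _ _) ⟩
  (x ∸ i) + areaFrom (suc i) xs + areaFrom (length xs + suc i) ys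
    ≡⟨ cong (λ j → (x ∸ i) + areaFrom (suc i) xs + areaFrom j ys) (+-suc (length xs) i) ⟩
  (x ∸ i) + areaFrom (suc i) xs + areaFrom (suc (length xs) + i) ys ∎
  where open ≡-Reasoning

areaFrom-replicate : ∀ i k → areaFrom (suc i) (replicate k (i + k)) ≡ k C 2
areaFrom-replicate i zero    = refl
areaFrom-replicate i (suc k) rewrite +-suc i k =
  trans (cong₂ _+_ (m+n∸m≡n i k) (areaFrom-replicate (suc i) k)) (sym (C2-suc k))

areaFrom-map-+ : ∀ k i hs → areaFrom (k + i) (map (k +_) hs) ≡ areaFrom i hs
areaFrom-map-+ k i []       = refl
areaFrom-map-+ k i (h ∷ hs) = cong₂ _+_ ([m+n]∸[m+o]≡n∸o k h i)
  (trans (cong (λ j → areaFrom j (map (k +_) hs)) (sym (+-suc k i))) (areaFrom-map-+ k (suc i) hs))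

area-pyramid : ∀ k w → area (pyramid k w) ≡ k C 2 + area w
area-pyramid k w = begin
  areaFrom 1 (heights (pyramid k w))
    ≡⟨ cong (areaFrom 1) (heights-pyramid k w) ⟩
  areaFrom 1 (replicate k k ++ map (k +_) (heights w))
    ≡⟨ areaFrom-++ 1 (replicate k k) _ ⟩
  areaFrom 1 (replicate k k) + areaFrom (length (replicate k k) + 1) (map (k +_) (heights w))
    ≡⟨ cong₂ (λ a j → a + areaFrom j (map (k +_) (heights w))) (areaFrom-replicate 0 k) (cong (_+ 1) (length-replicate k)) ⟩
  k C 2 + areaFrom (k + 1) (map (k +_) (heights w))
    ≡⟨ cong (k C 2 +_) (areaFrom-map-+ k 1 (heights w)) ⟩
  k C 2 + area w ∎
  where open ≡-Reasoning

nth-replicate-++ : ∀ k x ys i → nth (replicate k x ++ ys) (k + i) ≡ nth ys i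
nth-replicate-++ zero    x ys i = refl
nth-replicate-++ (suc k) x ys i = nth-replicate-++ k x ys i

nth-map : ∀ f xs {i} → i < length xs → nth (map f xs) i ≡ f (nth xs i)
nth-map f (x ∷ xs) {zero}  _        = refl
nth-map f (x ∷ xs) {suc i} (s≤s i<) = nth-map f xs i<

bounce-pyramid : ∀ j {m} w → IsDyck m w → bounce (suc j + m) (pyramid (suc j) w) ≡ m + bounce m w
bounce-pyramid j {m} w d = begin
  bounceFrom (k + m) (k + m) (heights (pyramid k w)) 0
    ≡⟨ cong (λ hs → bounceFrom (k + m) (k + m) hs 0) (heights-pyramid k w) ⟩
  ((k + m) ∸ k) + bounceAfter (j + m) (k + m) L k
    ≡⟨ cong₂ _+_ (m+n∸m≡n k m) (cong (bounceAfter (j + m) (k + m) L) (sym (+-identityʳ k))) ⟩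
  m + bounceAfter (j + m) (k + m) L (k + 0)
    ≡⟨ cong (m +_) (bounceAfter-shift L≡k+hs (j + m) 0) ⟩
  m + bounceAfter (j + m) m (heights w) 0
    ≡⟨ cong (m +_) (sym (bounce≡bounceAfter w d (m≤n+m m j))) ⟩
  m + bounce m w ∎
  where
  open ≡-Reasoning
  k = suc j
  L = replicate k k ++ map (k +_) (heights w)
  L≡k+hs : ∀ {i} → i < m → nth L (k + i) ≡ k + nth (heights w) i
  L≡k+hs {i} i<m = trans (nth-replicate-++ k k _ i)
    (nth-map (k +_) (heights w) (subst (i <_) (sym (DyckHeights.length≡ (dyckHeights w d))) i<m))

area+bounce-pyramid : ∀ j {m} w → IsDyck m w →
                      area+bounce (suc j + m) (pyramid (suc j) w) ≡ suc j C 2 + m + area+bounce m w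
area+bounce-pyramid j {m} w d =
  trans (cong₂ _+_ (area-pyramid (suc j) w) (bounce-pyramid j w d)) (interchange (suc j C 2) (area w) m (bounce m w))

Attains : ℕ → ℕ → Set
Attains n v = Σ (Dyck n) λ π → area+bounce n (proj₁ π) ≡ v

maximiser : ∀ {n} → n ≥ 1 → Attains n (n C 2)
maximiser {suc j} _ = subst (λ n → Attains n (n C 2)) (+-identityʳ (suc j))
  ( (pyramid (suc j) [] , pyramid-isDyck (suc j) [] (refl , refl))
  , (begin
      area+bounce (suc j + 0) (pyramid (suc j) [])   ≡⟨ area+bounce-pyramid j [] (refl , refl) ⟩
      suc j C 2 + 0 + 0                              ≡⟨ trans (+-identityʳ _) (+-identityʳ _) ⟩
      suc j C 2                                      ≡⟨ cong (_C 2) (sym (+-identityʳ (suc j))) ⟩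
      (suc j + 0) C 2                                ∎))
  where open ≡-Reasoning

minimiser : ∀ m → Σ (Dyck m) λ π → area+bounce m (proj₁ π) + g m ≡ m C 2
minimiser = <-rec Minimal build
  where
  open ≡-Reasoning
  Minimal : ℕ → Set
  Minimal m = Σ (Dyck m) λ π → area+bounce m (proj₁ π) + g m ≡ m C 2
  regroup : ∀ c r ab jr gr → (c + r + ab) + (jr + gr) ≡ c + (r + jr) + (ab + gr)
  regroup = solve-∀
  build : ∀ m → (∀ {r} → r < m → Minimal r) → Minimal m
  build zero    _   = ([] , refl , refl) , refl
  build (suc m) rec with g-attained m
  ... | j , r , refl , split≡g with rec (s≤s (m≤n+m r j))
  ... | (w , d) , w-minimal = (pyramid (suc j) w , pyramid-isDyck (suc j) w d) , (begin
    area+bounce (suc j + r) (pyramid (suc j) w) + g (suc j + r)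
      ≡⟨ cong₂ _+_ (area+bounce-pyramid j w d) (sym split≡g) ⟩
    (suc j C 2 + r + area+bounce r w) + (j * r + g r)
      ≡⟨ regroup (suc j C 2) r (area+bounce r w) (j * r) (g r) ⟩
    suc j C 2 + suc j * r + (area+bounce r w + g r)
      ≡⟨ cong (suc j C 2 + suc j * r +_) w-minimal ⟩
    suc j C 2 + suc j * r + r C 2
      ≡⟨ sym (C2-+ (suc j) r) ⟩
    (suc j + r) C 2 ∎)

lemma5p2 : (n : ℕ) → n ≥ 1 →
    (((π : Dyck n) → area (proj₁ π) + bounce n (proj₁ π) ≤ n C 2)
      × Σ (Dyck n) (λ π → area (proj₁ π) + bounce n (proj₁ π) ≡ n C 2))
    × (((π : Dyck n) → n C 2 ∸ g n ≤ area (proj₁ π) + bounce n (proj₁ π))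
      × Σ (Dyck n) (λ π → area (proj₁ π) + bounce n (proj₁ π) ≡ n C 2 ∸ g n))
lemma5p2 n n≥1 =
    ((λ (w , d) → area+bounce≤C2 w d) , maximiser n≥1)
  , ((λ (w , d) → C2∸g≤area+bounce w d) , minimum-attained)
  where
  minimum-attained : Attains n (n C 2 ∸ g n)
  minimum-attained with minimiser n
  ... | π , minimal = π , (begin
    area+bounce n (proj₁ π)               ≡⟨ sym (m+n∸n≡m _ (g n)) ⟩
    area+bounce n (proj₁ π) + g n ∸ g n   ≡⟨ cong (_∸ g n) minimal ⟩
    n C 2 ∸ g n                           ∎)
    where open ≡-Reasoning
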